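{- Let $F\colon\mathbf C\to\mathbf D$ be left adjoint to $U\colon\mathbf D\to\mathbf C$ (with $\mathbf C,\mathbf D$ having finite coproducts) and let $\mathbb S$ be an Elgot monad on $\mathbf D$. Then the monad induced on the composite functor $USF$ is an Elgot monad.
   Context: An Elgot monad is a monad $\mathbb S$ (unit $\eta$, Kleisli lifting $(-)^*$) with an operator assigning to every $f\colon X\to S(Y+X)$ a morphism $f^\dagger\colon X\to SY$ such that: fixpoint $f^\dagger=[\eta,f^\dagger]^*\circ f$; naturality $g^*\circ f^\dagger=([S(\mathrm{inl})\circ g,\eta\circ\mathrm{inr}]^*\circ f)^\dagger$ for $g\colon Y\to SZ$; codiagonal $(S[\mathrm{id},\mathrm{inr}]\circ f)^\dagger=(f^\dagger)^\dagger$ for $f\colon X\to S((Y+X)+X)$; uniformity: $f\circ h=S(\mathrm{id}+h)\circ g$ implies $f^\dagger\circ h=g^\dagger$ for $g\colon Z\to S(Y+Z)$, $h\colon Z\to X$. The induced monad on $USF$ is the standard composite of the adjunction's monad structure with $\mathbb S$ (unit $U\eta_F\circ$ adjunction unit, multiplication $U\mu^{\mathbb S}_F\circ US(\text{counit})_{SF}$). -}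

module Defs where

open import Level using (Level; _⊔_; suc)
open import Relation.Binary using (IsEquivalence)

record Category (o ℓ e : Level) : Set (suc (o ⊔ ℓ ⊔ e)) where
  infix  4 _≈_ _⇒_
  infixr 9 _∘_
  field
    Obj       : Set o
    _⇒_       : Obj → Obj → Set ℓ
    _≈_       : ∀ {A B} → (A ⇒ B) → (A ⇒ B) → Set e
    id        : ∀ {A} → A ⇒ A
    _∘_       : ∀ {A B C} → B ⇒ C → A ⇒ B → A ⇒ C
    equiv     : ∀ {A B} → IsEquivalence (_≈_ {A} {B})
    assoc     : ∀ {A B C D} {f : A ⇒ B} {g : B ⇒ C} {h : C ⇒ D} →
                (h ∘ g) ∘ f ≈ h ∘ (g ∘ f)
    identityˡ : ∀ {A B} {f : A ⇒ B} → id ∘ f ≈ f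
    identityʳ : ∀ {A B} {f : A ⇒ B} → f ∘ id ≈ f
    ∘-resp-≈  : ∀ {A B C} {f h : B ⇒ C} {g i : A ⇒ B} →
                f ≈ h → g ≈ i → f ∘ g ≈ h ∘ i

record Functor {o ℓ e o′ ℓ′ e′ : Level}
               (C : Category o ℓ e) (D : Category o′ ℓ′ e′)
               : Set (o ⊔ ℓ ⊔ e ⊔ o′ ⊔ ℓ′ ⊔ e′) where
  private
    module C = Category C
    module D = Category D
  field
    F₀           : C.Obj → D.Obj
    F₁           : ∀ {A B} → A C.⇒ B → F₀ A D.⇒ F₀ B
    identity     : ∀ {A} → F₁ (C.id {A}) D.≈ D.id
    homomorphism : ∀ {X Y Z} {f : X C.⇒ Y} {g : Y C.⇒ Z} →
                   F₁ (g C.∘ f) D.≈ F₁ g D.∘ F₁ f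
    F-resp-≈     : ∀ {A B} {f g : A C.⇒ B} → f C.≈ g → F₁ f D.≈ F₁ g

record Adjunction {o ℓ e o′ ℓ′ e′ : Level}
                  {C : Category o ℓ e} {D : Category o′ ℓ′ e′}
                  (F : Functor C D) (U : Functor D C)
                  : Set (o ⊔ ℓ ⊔ e ⊔ o′ ⊔ ℓ′ ⊔ e′) where
  private
    module C = Category C
    module D = Category D
    module F = Functor F
    module U = Functor U
  field
    unit          : ∀ X → X C.⇒ U.F₀ (F.F₀ X)
    counit        : ∀ A → F.F₀ (U.F₀ A) D.⇒ A
    unit-natural  : ∀ {X Y} (f : X C.⇒ Y) →
                    U.F₁ (F.F₁ f) C.∘ unit X C.≈ unit Y C.∘ f
    counit-natural : ∀ {A B} (g : A D.⇒ B) →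
                    counit B D.∘ F.F₁ (U.F₁ g) D.≈ g D.∘ counit A
    zig           : ∀ X → counit (F.F₀ X) D.∘ F.F₁ (unit X) D.≈ D.id
    zag           : ∀ A → U.F₁ (counit A) C.∘ unit (U.F₀ A) C.≈ C.id

module _ {o ℓ e : Level} (C : Category o ℓ e) where
  open Category C

  record Initial : Set (o ⊔ ℓ ⊔ e) where
    field
      ⊥        : Obj
      !        : ∀ {A} → ⊥ ⇒ A
      !-unique : ∀ {A} (f : ⊥ ⇒ A) → ! ≈ f

  record Coproduct (A B : Obj) : Set (o ⊔ ℓ ⊔ e) where
    field
      A+B     : Obj
      i₁      : A ⇒ A+B
      i₂      : B ⇒ A+B
      [_,_]   : ∀ {X} → A ⇒ X → B ⇒ X → A+B ⇒ X
      inject₁ : ∀ {X} {f : A ⇒ X} {g : B ⇒ X} → [ f , g ] ∘ i₁ ≈ f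
      inject₂ : ∀ {X} {f : A ⇒ X} {g : B ⇒ X} → [ f , g ] ∘ i₂ ≈ g
      unique  : ∀ {X} {h : A+B ⇒ X} {f : A ⇒ X} {g : B ⇒ X} →
                h ∘ i₁ ≈ f → h ∘ i₂ ≈ g → [ f , g ] ≈ h

  record FiniteCoproducts : Set (o ⊔ ℓ ⊔ e) where
    field
      initial   : Initial
      coproduct : ∀ A B → Coproduct A B

  record RawKleisli : Set (o ⊔ ℓ) where
    field
      T₀  : Obj → Obj
      η   : ∀ {X} → X ⇒ T₀ X
      _*  : ∀ {X Y} → X ⇒ T₀ Y → T₀ X ⇒ T₀ Y

  record IsMonad (M : RawKleisli) : Set (o ⊔ ℓ ⊔ e) where
    open RawKleisli M
    field
      *-identity : ∀ {X} → (η {X}) * ≈ id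
      *-unit     : ∀ {X Y} {f : X ⇒ T₀ Y} → (f *) ∘ η ≈ f
      *-assoc    : ∀ {X Y Z} {f : X ⇒ T₀ Y} {g : Y ⇒ T₀ Z} →
                   ((g *) ∘ f) * ≈ (g *) ∘ (f *)
      *-resp-≈   : ∀ {X Y} {f g : X ⇒ T₀ Y} → f ≈ g → f * ≈ g *

  module KleisliOps (M : RawKleisli) where
    open RawKleisli M
    T₁ : ∀ {X Y} → X ⇒ Y → T₀ X ⇒ T₀ Y
    T₁ f = (η ∘ f) *
    μ : ∀ {X} → T₀ (T₀ X) ⇒ T₀ X
    μ = id *

  record IsElgotMonad (cp : FiniteCoproducts) (M : RawKleisli)
                      : Set (o ⊔ ℓ ⊔ e) where
    open RawKleisli M
    open KleisliOps M
    private
      _+_ : Obj → Obj → Obj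
      A + B = Coproduct.A+B (FiniteCoproducts.coproduct cp A B)
      inl : ∀ {A B} → A ⇒ A + B
      inl {A} {B} = Coproduct.i₁ (FiniteCoproducts.coproduct cp A B)
      inr : ∀ {A B} → B ⇒ A + B
      inr {A} {B} = Coproduct.i₂ (FiniteCoproducts.coproduct cp A B)
      [_,_] : ∀ {A B X} → A ⇒ X → B ⇒ X → A + B ⇒ X
      [_,_] {A} {B} = Coproduct.[_,_] (FiniteCoproducts.coproduct cp A B)
      _+₁_ : ∀ {A B A′ B′} → A ⇒ A′ → B ⇒ B′ → A + B ⇒ A′ + B′
      f +₁ g = [ inl ∘ f , inr ∘ g ]
    field
      isMonad    : IsMonad M
      _†         : ∀ {X Y} → X ⇒ T₀ (Y + X) → X ⇒ T₀ Y
      †-resp-≈   : ∀ {X Y} {f g : X ⇒ T₀ (Y + X)} → f ≈ g → f † ≈ g †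
      fixpoint   : ∀ {X Y} {f : X ⇒ T₀ (Y + X)} →
                   f † ≈ ([ η , f † ] *) ∘ f
      naturality : ∀ {X Y Z} {f : X ⇒ T₀ (Y + X)} {g : Y ⇒ T₀ Z} →
                   (g *) ∘ (f †) ≈ (([ T₁ inl ∘ g , η ∘ inr ] *) ∘ f) †
      codiagonal : ∀ {X Y} {f : X ⇒ T₀ ((Y + X) + X)} →
                   (T₁ [ id , inr ] ∘ f) † ≈ (f †) †
      uniformity : ∀ {X Y Z} {f : X ⇒ T₀ (Y + X)} {g : Z ⇒ T₀ (Y + Z)}
                   {h : Z ⇒ X} →
                   f ∘ h ≈ T₁ (id +₁ h) ∘ g → (f †) ∘ h ≈ g †

-- The monad induced on U S F by an adjunction F ⊣ U and a monad S on D: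
-- unit U(η_F) ∘ unit, multiplication U(μ_F) ∘ U S (counit_{SF});
-- Kleisli lifting f ↦ μ ∘ USF(f).
inducedMonad : {o ℓ e o′ ℓ′ e′ : Level}
               {C : Category o ℓ e} {D : Category o′ ℓ′ e′}
               {F : Functor C D} {U : Functor D C} →
               Adjunction F U → RawKleisli D → RawKleisli C
inducedMonad {C = C} {D} {F} {U} adj S = record
  { T₀ = λ X → U.F₀ (S.T₀ (F.F₀ X))
  ; η  = λ {X} → U.F₁ (S.η {F.F₀ X}) C.∘ A.unit X
  ; _* = λ {X} {Y} f →
      (U.F₁ (SO.μ {F.F₀ Y}) C.∘ U.F₁ (SO.T₁ (A.counit (S.T₀ (F.F₀ Y)))))
        C.∘ U.F₁ (SO.T₁ (F.F₁ f))
  }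
  where
    module C = Category C
    module F = Functor F
    module U = Functor U
    module A = Adjunction adj
    module S = RawKleisli S
    module SO = KleisliOps D S

-- Transposition along F ⊣ U identifies Kleisli maps X → USFY of the composite
-- monad with Kleisli maps FX → SFY of S, compatibly with units and Kleisli
-- extension. A loop f : X → USF(Y + X) transposes to FX → SF(Y + X), and
-- composing with the comparison ψ : F(Y + X) → FY + FX (the inverse of
-- [F inl , F inr]) turns it into an S-loop on FX; the iterate of f is the
-- transpose of the S-iterate of that loop. Each Elgot law for the composite
-- monad is then the transpose of the same law for S, because ψ is natural and
-- ψ ∘ F inl = inl, ψ ∘ F inr = inr.
module Submission where

open import Level using (Level)
open import Relation.Binary using (Setoid; IsEquivalence)
import Relation.Binary.Reasoning.Setoid as SetoidReasoning
open import Defs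

module HomReasoning {o ℓ e : Level} (C : Category o ℓ e) where
  open Category C public

  hom-setoid : Obj → Obj → Setoid ℓ e
  hom-setoid A B = record { isEquivalence = equiv {A} {B} }

  module _ {A B : Obj} where
    open IsEquivalence (equiv {A} {B}) public
      renaming (refl to ≈-refl; sym to ≈-sym; trans to ≈-trans)
    open SetoidReasoning (hom-setoid A B) public

  infixr 4 _⟩∘⟨_

  _⟩∘⟨_ : ∀ {A B C} {f h : B ⇒ C} {g i : A ⇒ B} → f ≈ h → g ≈ i → f ∘ g ≈ h ∘ i
  _⟩∘⟨_ = ∘-resp-≈

  refl⟩∘⟨_ : ∀ {A B C} {f : B ⇒ C} {g i : A ⇒ B} → g ≈ i → f ∘ g ≈ f ∘ i
  refl⟩∘⟨ p = ∘-resp-≈ ≈-refl p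

  _⟩∘⟨refl : ∀ {A B C} {f h : B ⇒ C} {g : A ⇒ B} → f ≈ h → f ∘ g ≈ h ∘ g
  p ⟩∘⟨refl = ∘-resp-≈ p ≈-refl

  sym-assoc : ∀ {A B C D} {f : A ⇒ B} {g : B ⇒ C} {h : C ⇒ D} →
              h ∘ (g ∘ f) ≈ (h ∘ g) ∘ f
  sym-assoc = ≈-sym assoc

  pullˡ : ∀ {A B C D} {f : A ⇒ B} {g : B ⇒ C} {h : C ⇒ D} {k : B ⇒ D} →
          h ∘ g ≈ k → h ∘ (g ∘ f) ≈ k ∘ f
  pullˡ p = ≈-trans sym-assoc (p ⟩∘⟨refl)

module CoproductProperties {o ℓ e : Level} (C : Category o ℓ e)
                           (cp : FiniteCoproducts C) where
  open HomReasoning C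

  _+_ : Obj → Obj → Obj
  A + B = Coproduct.A+B (FiniteCoproducts.coproduct cp A B)

  module _ {A B : Obj} where
    open Coproduct (FiniteCoproducts.coproduct cp A B) public
      hiding (A+B) renaming (i₁ to inl; i₂ to inr)

  _+₁_ : ∀ {A B A′ B′} → A ⇒ A′ → B ⇒ B′ → A + B ⇒ A′ + B′
  f +₁ g = [ inl ∘ f , inr ∘ g ]

  []-cong : ∀ {A B X} {f f′ : A ⇒ X} {g g′ : B ⇒ X} → f ≈ f′ → g ≈ g′ →
            [ f , g ] ≈ [ f′ , g′ ]
  []-cong p q = ≈-sym (unique (≈-trans inject₁ p) (≈-trans inject₂ q))

  ∘[] : ∀ {A B X Y} {f : A ⇒ X} {g : B ⇒ X} {h : X ⇒ Y} →
        h ∘ [ f , g ] ≈ [ h ∘ f , h ∘ g ]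
  ∘[] = ≈-sym (unique (≈-trans assoc (refl⟩∘⟨ inject₁))
                      (≈-trans assoc (refl⟩∘⟨ inject₂)))

  []∘+₁ : ∀ {A B A′ B′ X} {f : A′ ⇒ X} {g : B′ ⇒ X} {a : A ⇒ A′} {b : B ⇒ B′} →
          [ f , g ] ∘ (a +₁ b) ≈ [ f ∘ a , g ∘ b ]
  []∘+₁ = ≈-trans ∘[] ([]-cong (pullˡ inject₁) (pullˡ inject₂))

  +₁-cong : ∀ {A B A′ B′} {f f′ : A ⇒ A′} {g g′ : B ⇒ B′} → f ≈ f′ → g ≈ g′ →
            f +₁ g ≈ f′ +₁ g′
  +₁-cong p q = []-cong (refl⟩∘⟨ p) (refl⟩∘⟨ q)

module KleisliProperties {o ℓ e : Level} (C : Category o ℓ e)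
                         (M : RawKleisli C) (isMonad : IsMonad C M) where
  open HomReasoning C
  open RawKleisli M
  open KleisliOps C M
  open IsMonad isMonad

  *∘η∘ : ∀ {X Y Z} {k : Y ⇒ T₀ Z} {a : X ⇒ Y} → k * ∘ (η ∘ a) ≈ k ∘ a
  *∘η∘ = pullˡ *-unit

  *∘* : ∀ {X Y Z} {k : Y ⇒ T₀ Z} {h : X ⇒ T₀ Y} → k * ∘ h * ≈ (k * ∘ h) *
  *∘* = ≈-sym *-assoc

  *∘T₁ : ∀ {X Y Z} {k : Y ⇒ T₀ Z} {a : X ⇒ Y} → k * ∘ T₁ a ≈ (k ∘ a) *
  *∘T₁ = ≈-trans *∘* (*-resp-≈ *∘η∘)

  T₁∘T₁ : ∀ {X Y Z} {a : Y ⇒ Z} {b : X ⇒ Y} → T₁ a ∘ T₁ b ≈ T₁ (a ∘ b)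
  T₁∘T₁ = ≈-trans *∘T₁ (*-resp-≈ assoc)

  T₁-resp-≈ : ∀ {X Y} {a b : X ⇒ Y} → a ≈ b → T₁ a ≈ T₁ b
  T₁-resp-≈ p = *-resp-≈ (refl⟩∘⟨ p)

module Transposition {o ℓ e o′ ℓ′ e′ : Level}
                     {C : Category o ℓ e} {D : Category o′ ℓ′ e′}
                     {F : Functor C D} {U : Functor D C}
                     (adj : Adjunction F U) where
  private
    module C = HomReasoning C
    module F = Functor F
    module U = Functor U
    module A = Adjunction adj
  open HomReasoning D

  ⌊_⌋ : ∀ {X B} → X C.⇒ U.F₀ B → F.F₀ X ⇒ B
  ⌊_⌋ {B = B} f = A.counit B ∘ F.F₁ f

  ⌈_⌉ : ∀ {X B} → F.F₀ X ⇒ B → X C.⇒ U.F₀ B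
  ⌈_⌉ {X = X} k = U.F₁ k C.∘ A.unit X

  ⌊⌋-resp-≈ : ∀ {X B} {f g : X C.⇒ U.F₀ B} → f C.≈ g → ⌊ f ⌋ ≈ ⌊ g ⌋
  ⌊⌋-resp-≈ p = refl⟩∘⟨ F.F-resp-≈ p

  ⌈⌉-resp-≈ : ∀ {X B} {f g : F.F₀ X ⇒ B} → f ≈ g → ⌈ f ⌉ C.≈ ⌈ g ⌉
  ⌈⌉-resp-≈ p = U.F-resp-≈ p C.⟩∘⟨refl

  ⌊⌈⌉⌋ : ∀ {X B} {k : F.F₀ X ⇒ B} → ⌊ ⌈ k ⌉ ⌋ ≈ k
  ⌊⌈⌉⌋ {X} {B} {k} = begin
    A.counit B ∘ F.F₁ (U.F₁ k C.∘ A.unit X)               ≈⟨ refl⟩∘⟨ F.homomorphism ⟩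
    A.counit B ∘ (F.F₁ (U.F₁ k) ∘ F.F₁ (A.unit X))        ≈⟨ pullˡ (A.counit-natural k) ⟩
    (k ∘ A.counit (F.F₀ X)) ∘ F.F₁ (A.unit X)             ≈⟨ assoc ⟩
    k ∘ (A.counit (F.F₀ X) ∘ F.F₁ (A.unit X))             ≈⟨ refl⟩∘⟨ A.zig X ⟩
    k ∘ id                                                ≈⟨ identityʳ ⟩
    k                                                     ∎

  ⌈⌊⌋⌉ : ∀ {X B} {f : X C.⇒ U.F₀ B} → ⌈ ⌊ f ⌋ ⌉ C.≈ f
  ⌈⌊⌋⌉ {X} {B} {f} = C.begin
    U.F₁ (A.counit B ∘ F.F₁ f) C.∘ A.unit X                   C.≈⟨ U.homomorphism C.⟩∘⟨refl ⟩
    (U.F₁ (A.counit B) C.∘ U.F₁ (F.F₁ f)) C.∘ A.unit X        C.≈⟨ C.assoc ⟩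
    U.F₁ (A.counit B) C.∘ (U.F₁ (F.F₁ f) C.∘ A.unit X)        C.≈⟨ C.refl⟩∘⟨ A.unit-natural f ⟩
    U.F₁ (A.counit B) C.∘ (A.unit (U.F₀ B) C.∘ f)             C.≈⟨ C.pullˡ (A.zag B) ⟩
    C.id C.∘ f                                                C.≈⟨ C.identityˡ ⟩
    f                                                         C.∎

  ⌊⌋-injective : ∀ {X B} {f g : X C.⇒ U.F₀ B} → ⌊ f ⌋ ≈ ⌊ g ⌋ → f C.≈ g
  ⌊⌋-injective p = C.≈-trans (C.≈-sym ⌈⌊⌋⌉) (C.≈-trans (⌈⌉-resp-≈ p) ⌈⌊⌋⌉)

  ⌊∘⌋ : ∀ {X Y B} {f : Y C.⇒ U.F₀ B} {h : X C.⇒ Y} → ⌊ f C.∘ h ⌋ ≈ ⌊ f ⌋ ∘ F.F₁ h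
  ⌊∘⌋ = ≈-trans (refl⟩∘⟨ F.homomorphism) sym-assoc

  ⌊U∘⌋ : ∀ {X B B′} {g : B ⇒ B′} {f : X C.⇒ U.F₀ B} → ⌊ U.F₁ g C.∘ f ⌋ ≈ g ∘ ⌊ f ⌋
  ⌊U∘⌋ {g = g} = ≈-trans (refl⟩∘⟨ F.homomorphism)
                         (≈-trans (pullˡ (A.counit-natural g)) assoc)

  U∘⌈⌉ : ∀ {X B B′} {g : B ⇒ B′} {k : F.F₀ X ⇒ B} → U.F₁ g C.∘ ⌈ k ⌉ C.≈ ⌈ g ∘ k ⌉
  U∘⌈⌉ = C.pullˡ (C.≈-sym U.homomorphism)

module CoproductComparison {o ℓ e o′ ℓ′ e′ : Level}
                           {C : Category o ℓ e} {D : Category o′ ℓ′ e′}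
                           {F : Functor C D} {U : Functor D C}
                           (adj : Adjunction F U)
                           (cpC : FiniteCoproducts C) (cpD : FiniteCoproducts D) where
  private
    module C = HomReasoning C
    module F = Functor F
    module U = Functor U
    module CC = CoproductProperties C cpC
  open HomReasoning D
  open CoproductProperties D cpD
  open Transposition adj

  Ψ : ∀ {Y X} → Y CC.+ X C.⇒ U.F₀ (F.F₀ Y + F.F₀ X)
  Ψ = CC.[ ⌈ inl ⌉ , ⌈ inr ⌉ ]

  ψ : ∀ {Y X} → F.F₀ (Y CC.+ X) ⇒ F.F₀ Y + F.F₀ X
  ψ = ⌊ Ψ ⌋

  ⌊[]⌋ : ∀ {Y X B} {a : Y C.⇒ U.F₀ B} {b : X C.⇒ U.F₀ B} →
         ⌊ CC.[ a , b ] ⌋ ≈ [ ⌊ a ⌋ , ⌊ b ⌋ ] ∘ ψ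
  ⌊[]⌋ {a = a} {b} = begin
    ⌊ CC.[ a , b ] ⌋                                      ≈⟨ ⌊⌋-resp-≈ (CC.[]-cong ⌈⌊⌋⌉ ⌈⌊⌋⌉) ⟨
    ⌊ CC.[ ⌈ ⌊ a ⌋ ⌉ , ⌈ ⌊ b ⌋ ⌉ ] ⌋                        ≈⟨ ⌊⌋-resp-≈ (CC.[]-cong (⌈⌉-resp-≈ inject₁)
                                                                               (⌈⌉-resp-≈ inject₂)) ⟨
    ⌊ CC.[ ⌈ [ ⌊ a ⌋ , ⌊ b ⌋ ] ∘ inl ⌉ , ⌈ [ ⌊ a ⌋ , ⌊ b ⌋ ] ∘ inr ⌉ ] ⌋
                                                          ≈⟨ ⌊⌋-resp-≈ (CC.[]-cong U∘⌈⌉ U∘⌈⌉) ⟨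
    ⌊ CC.[ U.F₁ [ ⌊ a ⌋ , ⌊ b ⌋ ] C.∘ ⌈ inl ⌉ , U.F₁ [ ⌊ a ⌋ , ⌊ b ⌋ ] C.∘ ⌈ inr ⌉ ] ⌋
                                                          ≈⟨ ⌊⌋-resp-≈ CC.∘[] ⟨
    ⌊ U.F₁ [ ⌊ a ⌋ , ⌊ b ⌋ ] C.∘ Ψ ⌋                        ≈⟨ ⌊U∘⌋ ⟩
    [ ⌊ a ⌋ , ⌊ b ⌋ ] ∘ ψ                                   ∎

  ⌊Ψ∘inl⌋ : ∀ {Y X} → ⌊ Ψ {Y} {X} C.∘ CC.inl ⌋ ≈ inl
  ⌊Ψ∘inl⌋ = ≈-trans (⌊⌋-resp-≈ CC.inject₁) ⌊⌈⌉⌋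

  ⌊Ψ∘inr⌋ : ∀ {Y X} → ⌊ Ψ {Y} {X} C.∘ CC.inr ⌋ ≈ inr
  ⌊Ψ∘inr⌋ = ≈-trans (⌊⌋-resp-≈ CC.inject₂) ⌊⌈⌉⌋

  ψ∘Finl : ∀ {Y X} → ψ {Y} {X} ∘ F.F₁ CC.inl ≈ inl
  ψ∘Finl = ≈-trans (≈-sym ⌊∘⌋) ⌊Ψ∘inl⌋

  ψ∘Finr : ∀ {Y X} → ψ {Y} {X} ∘ F.F₁ CC.inr ≈ inr
  ψ∘Finr = ≈-trans (≈-sym ⌊∘⌋) ⌊Ψ∘inr⌋

  ψ-natural : ∀ {Y X Y′ X′} {a : Y C.⇒ Y′} {b : X C.⇒ X′} →
              ψ ∘ F.F₁ (a CC.+₁ b) ≈ (F.F₁ a +₁ F.F₁ b) ∘ ψ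
  ψ-natural {a = a} {b} = begin
    ψ ∘ F.F₁ (a CC.+₁ b)                                  ≈⟨ ⌊∘⌋ ⟨
    ⌊ Ψ C.∘ (a CC.+₁ b) ⌋                                 ≈⟨ ⌊⌋-resp-≈ CC.∘[] ⟩
    ⌊ CC.[ Ψ C.∘ (CC.inl C.∘ a) , Ψ C.∘ (CC.inr C.∘ b) ] ⌋  ≈⟨ ⌊[]⌋ ⟩
    [ ⌊ Ψ C.∘ (CC.inl C.∘ a) ⌋ , ⌊ Ψ C.∘ (CC.inr C.∘ b) ⌋ ] ∘ ψ
      ≈⟨ []-cong (≈-trans (⌊⌋-resp-≈ C.sym-assoc) (≈-trans ⌊∘⌋ (⌊Ψ∘inl⌋ ⟩∘⟨refl)))
                 (≈-trans (⌊⌋-resp-≈ C.sym-assoc) (≈-trans ⌊∘⌋ (⌊Ψ∘inr⌋ ⟩∘⟨refl))) ⟩∘⟨refl ⟩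
    (F.F₁ a +₁ F.F₁ b) ∘ ψ                                ∎

  ψ-codiagonal : ∀ {Y X} →
                 [ id , inr ] ∘ ((ψ {Y} {X} +₁ id) ∘ ψ) ≈ ψ ∘ F.F₁ CC.[ C.id , CC.inr ]
  ψ-codiagonal = begin
    [ id , inr ] ∘ ((ψ +₁ id) ∘ ψ)                        ≈⟨ pullˡ (≈-trans []∘+₁ ([]-cong identityˡ identityʳ)) ⟩
    [ ψ , inr ] ∘ ψ                                       ≈⟨ []-cong (⌊⌋-resp-≈ C.identityʳ) ⌊Ψ∘inr⌋ ⟩∘⟨refl ⟨
    [ ⌊ Ψ C.∘ C.id ⌋ , ⌊ Ψ C.∘ CC.inr ⌋ ] ∘ ψ              ≈⟨ ⌊[]⌋ ⟨
    ⌊ CC.[ Ψ C.∘ C.id , Ψ C.∘ CC.inr ] ⌋                  ≈⟨ ⌊⌋-resp-≈ CC.∘[] ⟨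
    ⌊ Ψ C.∘ CC.[ C.id , CC.inr ] ⌋                        ≈⟨ ⌊∘⌋ ⟩
    ψ ∘ F.F₁ CC.[ C.id , CC.inr ]                         ∎

module InducedMonadProperties {o ℓ e o′ ℓ′ e′ : Level}
                              {C : Category o ℓ e} {D : Category o′ ℓ′ e′}
                              {F : Functor C D} {U : Functor D C}
                              (adj : Adjunction F U)
                              (S : RawKleisli D) (S-monad : IsMonad D S) where
  private
    module C = HomReasoning C
    module F = Functor F
    module U = Functor U
  open HomReasoning D
  open RawKleisli S
  open KleisliOps D S
  open IsMonad S-monad
  open KleisliProperties D S S-monad
  open Transposition adj

  USF : RawKleisli C
  USF = inducedMonad adj S

  module USF where
    open RawKleisli USF public
    open KleisliOps C USF public

  USF-*≈U⌊⌋* : ∀ {X Y} {f : X C.⇒ USF.T₀ Y} → f USF.* C.≈ U.F₁ (⌊ f ⌋ *)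
  USF-*≈U⌊⌋* = C.≈-trans (C.≈-sym U.homomorphism C.⟩∘⟨refl)
                 (C.≈-trans (C.≈-sym U.homomorphism) (U.F-resp-≈ μ∘T₁counit∘T₁F))
    where
      μ∘T₁counit∘T₁F : ∀ {X Y} {f : X C.⇒ USF.T₀ Y} →
                       (μ ∘ T₁ (Adjunction.counit adj (T₀ (F.F₀ Y)))) ∘ T₁ (F.F₁ f) ≈ ⌊ f ⌋ *
      μ∘T₁counit∘T₁F = ≈-trans (*∘T₁ ⟩∘⟨refl) (≈-trans *∘T₁ (*-resp-≈ (identityˡ ⟩∘⟨refl)))

  ⌊USF-*∘⌋ : ∀ {X Y Z} {k : Y C.⇒ USF.T₀ Z} {f : X C.⇒ USF.T₀ Y} →
             ⌊ k USF.* C.∘ f ⌋ ≈ ⌊ k ⌋ * ∘ ⌊ f ⌋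
  ⌊USF-*∘⌋ = ≈-trans (⌊⌋-resp-≈ (USF-*≈U⌊⌋* C.⟩∘⟨refl)) ⌊U∘⌋

  ⌊USF-η⌋ : ∀ {X} → ⌊ USF.η {X} ⌋ ≈ η
  ⌊USF-η⌋ = ⌊⌈⌉⌋

  ⌊USF-η∘⌋ : ∀ {X Y} {a : X C.⇒ Y} → ⌊ USF.η C.∘ a ⌋ ≈ η ∘ F.F₁ a
  ⌊USF-η∘⌋ = ≈-trans ⌊∘⌋ (⌊USF-η⌋ ⟩∘⟨refl)

  ⌊USF-T₁∘⌋ : ∀ {X Y Z} {a : Y C.⇒ Z} {f : X C.⇒ USF.T₀ Y} →
              ⌊ USF.T₁ a C.∘ f ⌋ ≈ T₁ (F.F₁ a) ∘ ⌊ f ⌋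
  ⌊USF-T₁∘⌋ = ≈-trans ⌊USF-*∘⌋ (*-resp-≈ ⌊USF-η∘⌋ ⟩∘⟨refl)

  USF-isMonad : IsMonad C USF
  USF-isMonad = record
    { *-identity = C.≈-trans USF-*≈U⌊⌋*
        (C.≈-trans (U.F-resp-≈ (≈-trans (*-resp-≈ ⌊USF-η⌋) *-identity)) U.identity)
    ; *-unit = ⌊⌋-injective (≈-trans ⌊USF-*∘⌋ (≈-trans (refl⟩∘⟨ ⌊USF-η⌋) *-unit))
    ; *-assoc = C.≈-trans USF-*≈U⌊⌋*
        (C.≈-trans (U.F-resp-≈ (≈-trans (*-resp-≈ ⌊USF-*∘⌋) *-assoc))
          (C.≈-trans U.homomorphism (C.≈-sym USF-*≈U⌊⌋* C.⟩∘⟨ C.≈-sym USF-*≈U⌊⌋*)))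
    ; *-resp-≈ = λ p → C.≈-trans USF-*≈U⌊⌋*
        (C.≈-trans (U.F-resp-≈ (*-resp-≈ (⌊⌋-resp-≈ p))) (C.≈-sym USF-*≈U⌊⌋*))
    }

module InducedElgotMonad {o ℓ e o′ ℓ′ e′ : Level}
                         {C : Category o ℓ e} {D : Category o′ ℓ′ e′}
                         {F : Functor C D} {U : Functor D C}
                         (adj : Adjunction F U)
                         (cpC : FiniteCoproducts C) (cpD : FiniteCoproducts D)
                         (S : RawKleisli D) (S-elgot : IsElgotMonad D cpD S) where
  private
    module C = HomReasoning C
    module CC = CoproductProperties C cpC
    module F = Functor F
    module E = IsElgotMonad S-elgot
  open HomReasoning D
  open CoproductProperties D cpD
  open RawKleisli S
  open KleisliOps D S
  open IsMonad E.isMonad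
  open KleisliProperties D S E.isMonad
  open Transposition adj
  open CoproductComparison adj cpC cpD
  open InducedMonadProperties adj S E.isMonad

  loop : ∀ {X Y} → X C.⇒ USF.T₀ (Y CC.+ X) → F.F₀ X ⇒ T₀ (F.F₀ Y + F.F₀ X)
  loop f = T₁ ψ ∘ ⌊ f ⌋

  _‡ : ∀ {X Y} → X C.⇒ USF.T₀ (Y CC.+ X) → X C.⇒ USF.T₀ Y
  f ‡ = ⌈ loop f E.† ⌉

  ⌊‡⌋ : ∀ {X Y} {f : X C.⇒ USF.T₀ (Y CC.+ X)} → ⌊ f ‡ ⌋ ≈ loop f E.†
  ⌊‡⌋ = ⌊⌈⌉⌋

  loop-T₁∘ : ∀ {X Y W Z} {a : W C.⇒ Y CC.+ X} {f : Z C.⇒ USF.T₀ W} →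
             T₁ ψ ∘ ⌊ USF.T₁ a C.∘ f ⌋ ≈ T₁ (ψ ∘ F.F₁ a) ∘ ⌊ f ⌋
  loop-T₁∘ = ≈-trans (refl⟩∘⟨ ⌊USF-T₁∘⌋) (pullˡ T₁∘T₁)

  ‡-resp-≈ : ∀ {X Y} {f g : X C.⇒ USF.T₀ (Y CC.+ X)} → f C.≈ g → f ‡ C.≈ g ‡
  ‡-resp-≈ p = ⌈⌉-resp-≈ (E.†-resp-≈ (refl⟩∘⟨ ⌊⌋-resp-≈ p))

  ‡-fixpoint : ∀ {X Y} {f : X C.⇒ USF.T₀ (Y CC.+ X)} →
               f ‡ C.≈ CC.[ USF.η , f ‡ ] USF.* C.∘ f
  ‡-fixpoint {f = f} = ⌊⌋-injective (begin
    ⌊ f ‡ ⌋                                          ≈⟨ ⌊‡⌋ ⟩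
    loop f E.†                                       ≈⟨ E.fixpoint ⟩
    [ η , loop f E.† ] * ∘ (T₁ ψ ∘ ⌊ f ⌋)             ≈⟨ pullˡ *∘T₁ ⟩
    ([ η , loop f E.† ] ∘ ψ) * ∘ ⌊ f ⌋               ≈⟨ *-resp-≈ ([]-cong ⌊USF-η⌋ ⌊‡⌋ ⟩∘⟨refl) ⟩∘⟨refl ⟨
    ([ ⌊ USF.η ⌋ , ⌊ f ‡ ⌋ ] ∘ ψ) * ∘ ⌊ f ⌋          ≈⟨ *-resp-≈ ⌊[]⌋ ⟩∘⟨refl ⟨
    ⌊ CC.[ USF.η , f ‡ ] ⌋ * ∘ ⌊ f ⌋                 ≈⟨ ⌊USF-*∘⌋ ⟨
    ⌊ CC.[ USF.η , f ‡ ] USF.* C.∘ f ⌋               ∎)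

  ‡-naturality : ∀ {X Y Z} {f : X C.⇒ USF.T₀ (Y CC.+ X)} {g : Y C.⇒ USF.T₀ Z} →
                 g USF.* C.∘ f ‡ C.≈ (CC.[ USF.T₁ CC.inl C.∘ g , USF.η C.∘ CC.inr ] USF.* C.∘ f) ‡
  ‡-naturality {f = f} {g} = ⌊⌋-injective (begin
    ⌊ g USF.* C.∘ f ‡ ⌋                          ≈⟨ ⌊USF-*∘⌋ ⟩
    ⌊ g ⌋ * ∘ ⌊ f ‡ ⌋                            ≈⟨ refl⟩∘⟨ ⌊‡⌋ ⟩
    ⌊ g ⌋ * ∘ loop f E.†                         ≈⟨ E.naturality ⟩
    (K * ∘ (T₁ ψ ∘ ⌊ f ⌋)) E.†                    ≈⟨ E.†-resp-≈ (pullˡ *∘T₁) ⟩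
    ((K ∘ ψ) * ∘ ⌊ f ⌋) E.†                      ≈⟨ E.†-resp-≈ (*-resp-≈ T₁ψ∘⌊h⌋ ⟩∘⟨refl) ⟨
    ((T₁ ψ ∘ ⌊ h ⌋) * ∘ ⌊ f ⌋) E.†               ≈⟨ E.†-resp-≈ (pullˡ *∘*) ⟨
    (T₁ ψ ∘ (⌊ h ⌋ * ∘ ⌊ f ⌋)) E.†               ≈⟨ E.†-resp-≈ (refl⟩∘⟨ ⌊USF-*∘⌋) ⟨
    loop (h USF.* C.∘ f) E.†                     ≈⟨ ⌊‡⌋ ⟨
    ⌊ (h USF.* C.∘ f) ‡ ⌋                        ∎)
    where
      h = CC.[ USF.T₁ CC.inl C.∘ g , USF.η C.∘ CC.inr ]
      K = [ T₁ inl ∘ ⌊ g ⌋ , η ∘ inr ]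
      T₁ψ∘⌊h⌋ : T₁ ψ ∘ ⌊ h ⌋ ≈ K ∘ ψ
      T₁ψ∘⌊h⌋ = begin
        T₁ ψ ∘ ⌊ h ⌋                                              ≈⟨ ≈-trans (refl⟩∘⟨ ⌊[]⌋) (pullˡ ∘[]) ⟩
        [ T₁ ψ ∘ ⌊ USF.T₁ CC.inl C.∘ g ⌋ , T₁ ψ ∘ ⌊ USF.η C.∘ CC.inr ⌋ ] ∘ ψ
          ≈⟨ []-cong (≈-trans loop-T₁∘ (T₁-resp-≈ ψ∘Finl ⟩∘⟨refl))
                     (≈-trans (refl⟩∘⟨ ⌊USF-η∘⌋) (≈-trans *∘η∘ (≈-trans assoc (refl⟩∘⟨ ψ∘Finr))))
             ⟩∘⟨refl ⟩
        K ∘ ψ                                                     ∎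

  ‡-codiagonal : ∀ {X Y} {f : X C.⇒ USF.T₀ ((Y CC.+ X) CC.+ X)} →
                 (USF.T₁ CC.[ C.id , CC.inr ] C.∘ f) ‡ C.≈ (f ‡) ‡
  ‡-codiagonal {f = f} = ⌊⌋-injective (begin
    ⌊ (USF.T₁ CC.[ C.id , CC.inr ] C.∘ f) ‡ ⌋         ≈⟨ ⌊‡⌋ ⟩
    loop (USF.T₁ CC.[ C.id , CC.inr ] C.∘ f) E.†      ≈⟨ E.†-resp-≈ loop-T₁∘ ⟩
    (T₁ (ψ ∘ F.F₁ CC.[ C.id , CC.inr ]) ∘ ⌊ f ⌋) E.†   ≈⟨ E.†-resp-≈ (T₁-resp-≈ ψ-codiagonal ⟩∘⟨refl) ⟨
    (T₁ ([ id , inr ] ∘ φ) ∘ ⌊ f ⌋) E.†               ≈⟨ E.†-resp-≈ (pullˡ T₁∘T₁) ⟨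
    (T₁ [ id , inr ] ∘ (T₁ φ ∘ ⌊ f ⌋)) E.†            ≈⟨ E.codiagonal ⟩
    ((T₁ φ ∘ ⌊ f ⌋) E.†) E.†                          ≈⟨ E.†-resp-≈ (E.†-resp-≈ K*∘loop) ⟨
    ((K * ∘ loop f) E.†) E.†                          ≈⟨ E.†-resp-≈ E.naturality ⟨
    (T₁ ψ ∘ loop f E.†) E.†                           ≈⟨ E.†-resp-≈ (refl⟩∘⟨ ⌊‡⌋) ⟨
    loop (f ‡) E.†                                    ≈⟨ ⌊‡⌋ ⟨
    ⌊ (f ‡) ‡ ⌋                                       ∎)
    where
      φ = (ψ +₁ id) ∘ ψ
      K = [ T₁ inl ∘ (η ∘ ψ) , η ∘ inr ]
      K≈η∘ψ+₁id : K ≈ η ∘ (ψ +₁ id)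
      K≈η∘ψ+₁id = ≈-trans ([]-cong (≈-trans *∘η∘ assoc) (refl⟩∘⟨ ≈-sym identityʳ))
                          (≈-sym ∘[])
      K*∘loop : K * ∘ loop f ≈ T₁ φ ∘ ⌊ f ⌋
      K*∘loop = ≈-trans (*-resp-≈ K≈η∘ψ+₁id ⟩∘⟨refl) (pullˡ T₁∘T₁)

  ‡-uniformity : ∀ {X Y Z} {f : X C.⇒ USF.T₀ (Y CC.+ X)} {g : Z C.⇒ USF.T₀ (Y CC.+ Z)}
                 {h : Z C.⇒ X} →
                 f C.∘ h C.≈ USF.T₁ (C.id CC.+₁ h) C.∘ g → f ‡ C.∘ h C.≈ g ‡
  ‡-uniformity {f = f} {g} {h} p = ⌊⌋-injective (begin
    ⌊ f ‡ C.∘ h ⌋              ≈⟨ ⌊∘⌋ ⟩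
    ⌊ f ‡ ⌋ ∘ F.F₁ h           ≈⟨ ⌊‡⌋ ⟩∘⟨refl ⟩
    loop f E.† ∘ F.F₁ h        ≈⟨ E.uniformity loop-uniform ⟩
    loop g E.†                 ≈⟨ ⌊‡⌋ ⟨
    ⌊ g ‡ ⌋                    ∎)
    where
      loop-uniform : loop f ∘ F.F₁ h ≈ T₁ (id +₁ F.F₁ h) ∘ loop g
      loop-uniform = begin
        (T₁ ψ ∘ ⌊ f ⌋) ∘ F.F₁ h                        ≈⟨ assoc ⟩
        T₁ ψ ∘ (⌊ f ⌋ ∘ F.F₁ h)                        ≈⟨ refl⟩∘⟨ ⌊∘⌋ ⟨
        T₁ ψ ∘ ⌊ f C.∘ h ⌋                             ≈⟨ refl⟩∘⟨ ⌊⌋-resp-≈ p ⟩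
        T₁ ψ ∘ ⌊ USF.T₁ (C.id CC.+₁ h) C.∘ g ⌋         ≈⟨ loop-T₁∘ ⟩
        T₁ (ψ ∘ F.F₁ (C.id CC.+₁ h)) ∘ ⌊ g ⌋           ≈⟨ T₁-resp-≈ ψ∘F[id+₁h] ⟩∘⟨refl ⟩
        T₁ ((id +₁ F.F₁ h) ∘ ψ) ∘ ⌊ g ⌋                ≈⟨ pullˡ T₁∘T₁ ⟨
        T₁ (id +₁ F.F₁ h) ∘ (T₁ ψ ∘ ⌊ g ⌋)             ∎
        where
          ψ∘F[id+₁h] : ψ ∘ F.F₁ (C.id CC.+₁ h) ≈ (id +₁ F.F₁ h) ∘ ψ
          ψ∘F[id+₁h] = ≈-trans ψ-natural (+₁-cong F.identity ≈-refl ⟩∘⟨refl)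

  isElgotMonad : IsElgotMonad C cpC USF
  isElgotMonad = record
    { isMonad    = USF-isMonad
    ; _†         = _‡
    ; †-resp-≈   = ‡-resp-≈
    ; fixpoint   = ‡-fixpoint
    ; naturality = ‡-naturality
    ; codiagonal = ‡-codiagonal
    ; uniformity = ‡-uniformity
    }

theorem6p2 : {o ℓ e o′ ℓ′ e′ : Level}
             (C : Category o ℓ e) (D : Category o′ ℓ′ e′)
             (cpC : FiniteCoproducts C) (cpD : FiniteCoproducts D)
             (F : Functor C D) (U : Functor D C) (adj : Adjunction F U)
             (S : RawKleisli D) → IsElgotMonad D cpD S →
             IsElgotMonad C cpC (inducedMonad adj S)
theorem6p2 C D cpC cpD F U adj S S-elgot =
  InducedElgotMonad.isElgotMonad adj cpC cpD S S-elgot
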